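{- Let $n \geq 2$ be even and let $m$ be a prime with $m \equiv -1 \pmod n$. Then $\mathbb{Z}_m^n$ is $H$-closed. Namely, if $\mathbf{u} \in K(\mathbb{Z}_m^n)$, then $D^{m-1}(\mathbf{u})=H^{ -1}(\mathbf{u})$.
   Context: The Ducci function is the endomorphism $D$ of $\mathbb{Z}_m^n$ given by $D(x_1,\dots,x_n)=(x_1+x_2 \bmod m, x_2+x_3 \bmod m,\dots,x_n+x_1 \bmod m)$, and $H$ is the endomorphism $H(x_1,\dots,x_n)=(x_2,x_3,\dots,x_n,x_1)$; $H^{ -1}$ is its inverse, $H^{ -1}(x_1,\dots,x_n)=(x_n,x_1,\dots,x_{n-1})$. The Ducci sequence of $\mathbf{u}$ is $\{D^{\alpha}(\mathbf{u})\}_{\alpha \geq 0}$. The Ducci cycle of $\mathbf{u}$ is the set of $\mathbf{v}$ for which there exist integers $\alpha \geq 0$, $\beta \geq 1$ with $\mathbf{v}=D^{\alpha+\beta}(\mathbf{u})=D^{\alpha}(\mathbf{u})$. $K(\mathbb{Z}_m^n)$ is the set of all tuples in $\mathbb{Z}_m^n$ that belong to the Ducci cycle of some $\mathbf{u} \in \mathbb{Z}_m^n$. The Ducci sequence of $\mathbf{u}$ is called $H$-closed if for every $\mathbf{v}$ in the Ducci cycle of $\mathbf{u}$ and every $-n<\beta<n$, $H^{\beta}(\mathbf{v})$ also belongs to the Ducci cycle of $\mathbf{u}$; $\mathbb{Z}_m^n$ is called $H$-closed if the Ducci sequence of every $\mathbf{u} \in \mathbb{Z}_m^n$ is $H$-closed.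 -}

module Defs where

open import Data.Nat using (ℕ; zero; suc; _+_; _<_)
open import Data.Nat.DivMod using (_mod_)
open import Data.Fin using (Fin; toℕ)
open import Data.Vec using (Vec; []; _∷_; _∷ʳ_; zipWith; last; init)
open import Data.Integer as ℤ using (ℤ; +_; -[1+_])
open import Data.Product using (Σ; ∃; _×_)
open import Relation.Binary.PropositionalEquality using (_≡_)

_+ₘ_ : {m : ℕ} → Fin m → Fin m → Fin m
_+ₘ_ {suc k} a b = (toℕ a + toℕ b) mod (suc k)

Tuple : ℕ → ℕ → Set
Tuple n m = Vec (Fin m) n

H : {A : Set} {n : ℕ} → Vec A n → Vec A n
H []       = []
H (x ∷ xs) = xs ∷ʳ x

Hinv : {A : Set} {n : ℕ} → Vec A n → Vec A n
Hinv {n = zero}  []         = []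
Hinv {n = suc n} xs@(_ ∷ _) = last xs ∷ init xs

D : {n m : ℕ} → Tuple n m → Tuple n m
D x = zipWith _+ₘ_ x (H x)

iter : {X : Set} → (X → X) → ℕ → X → X
iter f zero    x = x
iter f (suc k) x = f (iter f k x)

Hpow : {A : Set} {n : ℕ} → ℤ → Vec A n → Vec A n
Hpow (+ k)      = iter H k
Hpow -[1+ k ]   = iter Hinv (suc k)

InCycle : {n m : ℕ} → Tuple n m → Tuple n m → Set
InCycle u v = Σ ℕ λ α → Σ ℕ λ β → (1 Data.Nat.≤ β) × (v ≡ iter D (α + β) u) × (v ≡ iter D α u)

InK : {n m : ℕ} → Tuple n m → Set
InK {n} {m} v = ∃ λ (u : Tuple n m) → InCycle u v

HClosedSeq : {n m : ℕ} → Tuple n m → Set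
HClosedSeq {n} u = ∀ v → InCycle u v → ∀ (β : ℤ) → ℤ.- (+ n) ℤ.< β → β ℤ.< + n → InCycle u (Hpow β v)

HClosed : ℕ → ℕ → Set
HClosed n m = ∀ (u : Tuple n m) → HClosedSeq u

-- Over ℤ_p the Ducci map is D = 1 + H; as 1 and H commute and p divides (p choose j)
-- for 0 < j < p, the binomial theorem gives D^p = 1 + H^p.  Since H^n = 1
-- and n ∣ p + 1, H^p = H⁻¹, hence H ∘ D^p = H + 1 = D, i.e. D^(p-1) = H⁻¹ on the image
-- of D.  Every tuple of a Ducci cycle lies in that image, so cycles are closed under
-- H⁻¹ = D^(p-1) and under H = (H⁻¹)^(n-1).
module Submission where

open import Defs
open import Data.Nat using (ℕ; zero; suc; _+_; _*_; _<_; _≤_; _∸_; _%_; z≤n; s≤s; NonZero)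
open import Data.Nat.Properties
open import Data.Nat.Combinatorics using (_C_; nCn≡1; nC1≡n; k>n⇒nCk≡0; nCk+nC[k+1]≡[n+1]C[k+1])
open import Data.Nat.DivMod using (%-distribˡ-+; m<n⇒m%n≡m; %-remove-+ʳ)
open import Data.Nat.Divisibility using (_∣_; divides; divides-refl; ∣⇒≤; ∣-trans; m∣m*n; ∣m∣n⇒∣m+n)
open import Data.Nat.Primality using (Prime; euclidsLemma; prime⇒nonZero)
open import Data.Nat.Tactic.RingSolver using (solve-∀)
open import Data.Fin using (Fin; toℕ)
open import Data.Fin.Properties using (toℕ-fromℕ<; toℕ-injective; toℕ<n)
open import Data.Vec as Vec using (Vec; []; _∷_; _∷ʳ_; zipWith; toList)
open import Data.Vec.Properties using (toList-injective; cast-is-id; toList-∷ʳ; length-toList; last-∷ʳ; init-∷ʳ)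
open import Data.List as List using (List; _++_; [_])
open import Data.List.Properties using (++-assoc; ++-identityʳ)
open import Data.Maybe using (just)
open import Data.Maybe.Properties using (just-injective)
import Data.Integer as ℤ
open import Data.Product using (_×_; ∃; _,_)
open import Data.Sum using (inj₁; inj₂)
open import Data.Empty using (⊥-elim)
open import Relation.Binary.PropositionalEquality
  using (_≡_; refl; sym; trans; cong; cong₂; subst; module ≡-Reasoning)

private
  variable
    A : Set
    k q : ℕ

iter-suc : (f : A → A) (n : ℕ) (x : A) → iter f (suc n) x ≡ iter f n (f x)
iter-suc f zero    x = refl
iter-suc f (suc n) x = cong f (iter-suc f n x)

iter-+ : (f : A → A) (m n : ℕ) (x : A) → iter f (m + n) x ≡ iter f m (iter f n x)
iter-+ f zero    n x = refl
iter-+ f (suc m) n x = cong f (iter-+ f m n x)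

rotate : List A → List A
rotate List.[]       = List.[]
rotate (x List.∷ xs) = xs ++ [ x ]

iter-rotate-length : (xs ys : List A) → iter rotate (List.length xs) (xs ++ ys) ≡ ys ++ xs
iter-rotate-length List.[]       ys = sym (++-identityʳ ys)
iter-rotate-length (x List.∷ xs) ys = begin
  iter rotate (suc (List.length xs)) (x List.∷ xs ++ ys) ≡⟨ iter-suc rotate (List.length xs) _ ⟩
  iter rotate (List.length xs) ((xs ++ ys) ++ [ x ])     ≡⟨ cong (iter rotate (List.length xs)) (++-assoc xs ys [ x ]) ⟩
  iter rotate (List.length xs) (xs ++ ys ++ [ x ])       ≡⟨ iter-rotate-length xs (ys ++ [ x ]) ⟩
  (ys ++ [ x ]) ++ xs                                    ≡⟨ ++-assoc ys [ x ] xs ⟩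
  ys ++ x List.∷ xs                                      ∎
  where open ≡-Reasoning

head-iter-rotate : ∀ i (xs ys : List A) → i < List.length xs →
                   List.head (iter rotate i (xs ++ ys)) ≡ List.head (List.drop i xs)
head-iter-rotate zero    (x List.∷ xs) ys _         = refl
head-iter-rotate (suc i) (x List.∷ xs) ys (s≤s i<n) = begin
  List.head (iter rotate (suc i) (x List.∷ xs ++ ys)) ≡⟨ cong List.head (iter-suc rotate i _) ⟩
  List.head (iter rotate i ((xs ++ ys) ++ [ x ]))     ≡⟨ cong (λ l → List.head (iter rotate i l)) (++-assoc xs ys [ x ]) ⟩
  List.head (iter rotate i (xs ++ ys ++ [ x ]))       ≡⟨ head-iter-rotate i xs (ys ++ [ x ]) i<n ⟩
  List.head (List.drop i xs)                          ∎
  where open ≡-Reasoning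

head-drop-ext : (xs ys : List A) → List.length xs ≡ List.length ys →
                (∀ i → i < List.length xs → List.head (List.drop i xs) ≡ List.head (List.drop i ys)) →
                xs ≡ ys
head-drop-ext List.[]       List.[]       _   _    = refl
head-drop-ext (x List.∷ xs) (y List.∷ ys) len same =
  cong₂ List._∷_ (just-injective (same 0 (s≤s z≤n)))
                 (head-drop-ext xs ys (suc-injective len) (λ i i<n → same (suc i) (s≤s i<n)))

toList-injective′ : (xs ys : Vec A k) → toList xs ≡ toList ys → xs ≡ ys
toList-injective′ xs ys eq = trans (sym (cast-is-id refl xs)) (toList-injective refl xs ys eq)

toList-iter-H : ∀ i (x : Vec A k) → toList (iter H i x) ≡ iter rotate i (toList x)
toList-iter-H zero    x = refl
toList-iter-H (suc i) x = trans (toList-H (iter H i x)) (cong rotate (toList-iter-H i x))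
  where
  toList-H : (y : Vec A k) → toList (H y) ≡ rotate (toList y)
  toList-H []      = refl
  toList-H (y ∷ ys) = toList-∷ʳ y ys

iter-H-length : (x : Vec A k) → iter H k x ≡ x
iter-H-length {k = k} x = toList-injective′ _ x (begin
  toList (iter H k x)                                        ≡⟨ toList-iter-H k x ⟩
  iter rotate k (toList x)                                   ≡⟨ cong (λ n → iter rotate n (toList x)) (sym (length-toList x)) ⟩
  iter rotate (List.length (toList x)) (toList x)            ≡⟨ cong (iter rotate (List.length (toList x))) (sym (++-identityʳ (toList x))) ⟩
  iter rotate (List.length (toList x)) (toList x ++ List.[]) ≡⟨ iter-rotate-length (toList x) List.[] ⟩
  toList x                                                   ∎)
  where open ≡-Reasoning

entry : Vec A (suc k) → ℕ → A
entry x i = Vec.head (iter H i x)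

entry-ext : (x y : Vec A (suc k)) → (∀ i → entry x i ≡ entry y i) → x ≡ y
entry-ext {k = k} x y same = toList-injective′ x y
  (head-drop-ext (toList x) (toList y) (trans (length-toList x) (sym (length-toList y))) λ i i<n →
    let i<n′ = subst (i <_) (length-toList x) i<n in
    trans (head-drop x i i<n′) (trans (cong just (same i)) (sym (head-drop y i i<n′))))
  where
  head-toList : (z : Vec A (suc k)) → List.head (toList z) ≡ just (Vec.head z)
  head-toList (z ∷ _) = refl

  head-drop : (z : Vec A (suc k)) → ∀ i → i < suc k → List.head (List.drop i (toList z)) ≡ just (entry z i)
  head-drop z i i<n = begin
    List.head (List.drop i (toList z))              ≡⟨ head-iter-rotate i (toList z) List.[] i<n′ ⟨
    List.head (iter rotate i (toList z ++ List.[])) ≡⟨ cong (λ l → List.head (iter rotate i l)) (++-identityʳ _) ⟩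
    List.head (iter rotate i (toList z))            ≡⟨ cong List.head (toList-iter-H i z) ⟨
    List.head (toList (iter H i z))                 ≡⟨ head-toList (iter H i z) ⟩
    just (entry z i)                                ∎
    where
    open ≡-Reasoning
    i<n′ = subst (i <_) (sym (length-toList z)) i<n

entry-H : (x : Vec A (suc k)) (i : ℕ) → entry (H x) i ≡ entry x (suc i)
entry-H x i = cong Vec.head (sym (iter-suc H i x))

entry-periodic : ∀ {d} (x : Vec A (suc k)) (i : ℕ) → suc k ∣ d → entry x (i + d) ≡ entry x i
entry-periodic {k = k} x i (divides-refl c) =
  cong Vec.head (trans (iter-+ H i (c * suc k) x) (cong (iter H i) (iter-H-multiple c)))
  where
  iter-H-multiple : ∀ c → iter H (c * suc k) x ≡ x
  iter-H-multiple zero    = refl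
  iter-H-multiple (suc c) = begin
    iter H (suc k + c * suc k) x          ≡⟨ iter-+ H (suc k) (c * suc k) x ⟩
    iter H (suc k) (iter H (c * suc k) x) ≡⟨ cong (iter H (suc k)) (iter-H-multiple c) ⟩
    iter H (suc k) x                      ≡⟨ iter-H-length x ⟩
    x                                     ∎
    where open ≡-Reasoning

H-zipWith : (f : A → A → A) (xs ys : Vec A k) → H (zipWith f xs ys) ≡ zipWith f (H xs) (H ys)
H-zipWith f []       []       = refl
H-zipWith f (x ∷ xs) (y ∷ ys) = zipWith-∷ʳ xs ys
  where
  zipWith-∷ʳ : ∀ {n} (as bs : Vec _ n) → zipWith f as bs ∷ʳ f x y ≡ zipWith f (as ∷ʳ x) (bs ∷ʳ y)
  zipWith-∷ʳ []       []       = refl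
  zipWith-∷ʳ (a ∷ as) (b ∷ bs) = cong (f a b ∷_) (zipWith-∷ʳ as bs)

iter-H-D : ∀ i (x : Tuple k q) → iter H i (D x) ≡ D (iter H i x)
iter-H-D zero    x = refl
iter-H-D (suc i) x = trans (cong H (iter-H-D i x)) (H-zipWith _+ₘ_ (iter H i x) (H (iter H i x)))

entry-D : (x : Tuple (suc k) q) (i : ℕ) → entry (D x) i ≡ entry x i +ₘ entry x (suc i)
entry-D x i = trans (cong Vec.head (iter-H-D i x)) (head-zipWith (iter H i x) (H (iter H i x)))
  where
  head-zipWith : (y z : Tuple (suc k) q) → Vec.head (zipWith _+ₘ_ y z) ≡ Vec.head y +ₘ Vec.head z
  head-zipWith (_ ∷ _) (_ ∷ _) = refl

Hinv-H : (x : Vec A k) → Hinv (H x) ≡ x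
Hinv-H []           = refl
Hinv-H (y ∷ [])     = refl
Hinv-H (y ∷ z ∷ zs) = cong₂ _∷_ (last-∷ʳ y (z ∷ zs)) (init-∷ʳ y (z ∷ zs))

H≡Hinv^[n-1] : (x : Vec A (suc k)) → H x ≡ iter Hinv k x
H≡Hinv^[n-1] {k = k} x = sym (begin
  iter Hinv k x                  ≡⟨ cong (iter Hinv k) (sym (iter-H-length x)) ⟩
  iter Hinv k (iter H (suc k) x) ≡⟨ cong (iter Hinv k) (iter-suc H k x) ⟩
  iter Hinv k (iter H k (H x))   ≡⟨ iter-Hinv-iter-H k (H x) ⟩
  H x                            ∎)
  where
  open ≡-Reasoning
  iter-Hinv-iter-H : ∀ j (y : Vec A (suc k)) → iter Hinv j (iter H j y) ≡ y
  iter-Hinv-iter-H zero    y = refl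
  iter-Hinv-iter-H (suc j) y = begin
    iter Hinv (suc j) (H (iter H j y))  ≡⟨ iter-suc Hinv j _ ⟩
    iter Hinv j (Hinv (H (iter H j y))) ≡⟨ cong (iter Hinv j) (Hinv-H (iter H j y)) ⟩
    iter Hinv j (iter H j y)            ≡⟨ iter-Hinv-iter-H j y ⟩
    y                                   ∎

[k+1]*[n+1]C[k+1]≡[n+1]*nCk : ∀ n k → suc k * (suc n C suc k) ≡ suc n * (n C k)
[k+1]*[n+1]C[k+1]≡[n+1]*nCk zero    zero    = refl
[k+1]*[n+1]C[k+1]≡[n+1]*nCk zero    (suc k) = *-zeroʳ (suc (suc k))
[k+1]*[n+1]C[k+1]≡[n+1]*nCk (suc n) zero    =
  trans (*-identityˡ (suc (suc n) C 1)) (trans (nC1≡n (suc (suc n))) (sym (*-identityʳ (suc (suc n)))))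
[k+1]*[n+1]C[k+1]≡[n+1]*nCk (suc n) (suc k) = begin
  suc (suc k) * (suc (suc n) C suc (suc k))                  ≡⟨ cong (suc (suc k) *_) (sym (pascal (suc n) (suc k))) ⟩
  suc (suc k) * (suc n C suc k + suc n C suc (suc k))        ≡⟨ distrib (suc n C suc k) (suc n C suc (suc k)) ⟩
  suc k * (suc n C suc k) + suc n C suc k + suc (suc k) * (suc n C suc (suc k))
    ≡⟨ cong₂ (λ a b → a + suc n C suc k + b) ([k+1]*[n+1]C[k+1]≡[n+1]*nCk n k) ([k+1]*[n+1]C[k+1]≡[n+1]*nCk n (suc k)) ⟩
  suc n * (n C k) + suc n C suc k + suc n * (n C suc k)      ≡⟨ collect (n C k) (suc n C suc k) (n C suc k) ⟩
  suc n * (n C k + n C suc k) + suc n C suc k                ≡⟨ cong (λ a → suc n * a + suc n C suc k) (pascal n k) ⟩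
  suc n * (suc n C suc k) + suc n C suc k                    ≡⟨ +-comm (suc n * (suc n C suc k)) _ ⟩
  suc (suc n) * (suc n C suc k)                              ∎
  where
  open ≡-Reasoning
  pascal = nCk+nC[k+1]≡[n+1]C[k+1]
  distrib : ∀ a b → suc (suc k) * (a + b) ≡ suc k * a + a + suc (suc k) * b
  distrib = distrib′ k
    where
    distrib′ : ∀ k a b → suc (suc k) * (a + b) ≡ suc k * a + a + suc (suc k) * b
    distrib′ = solve-∀
  collect : ∀ a b c → suc n * a + b + suc n * c ≡ suc n * (a + c) + b
  collect = collect′ n
    where
    collect′ : ∀ n a b c → suc n * a + b + suc n * c ≡ suc n * (a + c) + b
    collect′ = solve-∀

prime⇒p∣pCk : ∀ {p j} → Prime p → 0 < j → j < p → p ∣ p C j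
prime⇒p∣pCk {suc p} {suc j} p-prime _ j<p
  with euclidsLemma (suc j) (suc p C suc j) p-prime
         (divides (p C j) (trans ([k+1]*[n+1]C[k+1]≡[n+1]*nCk p j) (*-comm (suc p) (p C j))))
... | inj₁ p∣j = ⊥-elim (<⇒≱ j<p (∣⇒≤ p∣j))
... | inj₂ p∣C = p∣C

∑< : ℕ → (ℕ → ℕ) → ℕ
∑< zero    f = 0
∑< (suc n) f = f 0 + ∑< n (λ j → f (suc j))

∑<-cong : ∀ n {f g : ℕ → ℕ} → (∀ j → f j ≡ g j) → ∑< n f ≡ ∑< n g
∑<-cong zero    f≗g = refl
∑<-cong (suc n) f≗g = cong₂ _+_ (f≗g 0) (∑<-cong n (λ j → f≗g (suc j)))

∑<-distrib-+ : ∀ n (f g : ℕ → ℕ) → ∑< n (λ j → f j + g j) ≡ ∑< n f + ∑< n g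
∑<-distrib-+ zero    f g = refl
∑<-distrib-+ (suc n) f g = trans (cong (f 0 + g 0 +_) (∑<-distrib-+ n _ _)) (interchange (f 0) (g 0) _ _)
  where
  interchange : ∀ a b c d → a + b + (c + d) ≡ a + c + (b + d)
  interchange = solve-∀

∑<-last : ∀ n (f : ℕ → ℕ) → ∑< (suc n) f ≡ ∑< n f + f n
∑<-last zero    f = +-comm (f 0) 0
∑<-last (suc n) f = trans (cong (f 0 +_) (∑<-last n (λ j → f (suc j)))) (sym (+-assoc (f 0) _ _))

∣-∑< : ∀ {d} n (f : ℕ → ℕ) → (∀ j → j < n → d ∣ f j) → d ∣ ∑< n f
∣-∑< zero    f d∣f = divides 0 refl
∣-∑< (suc n) f d∣f = ∣m∣n⇒∣m+n (d∣f 0 (s≤s z≤n)) (∣-∑< n _ (λ j j<n → d∣f (suc j) (s≤s j<n)))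

∑<-pascal : ∀ n (f : ℕ → ℕ) →
  ∑< (suc n) (λ j → (suc n C suc j) * f j) ≡ ∑< (suc n) (λ j → (n C j) * f j) + ∑< n (λ j → (n C suc j) * f j)
∑<-pascal n f = begin
  ∑< (suc n) (λ j → (suc n C suc j) * f j)             ≡⟨ ∑<-cong (suc n) split ⟩
  ∑< (suc n) (λ j → (n C j) * f j + (n C suc j) * f j) ≡⟨ ∑<-distrib-+ (suc n) (λ j → (n C j) * f j) (λ j → (n C suc j) * f j) ⟩
  ∑< (suc n) (λ j → (n C j) * f j) + ∑< (suc n) (λ j → (n C suc j) * f j)
    ≡⟨ cong (∑< (suc n) (λ j → (n C j) * f j) +_) (∑<-last n (λ j → (n C suc j) * f j)) ⟩
  ∑< (suc n) (λ j → (n C j) * f j) + (∑< n (λ j → (n C suc j) * f j) + (n C suc n) * f n)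
    ≡⟨ cong (λ c → ∑< (suc n) (λ j → (n C j) * f j) + (∑< n (λ j → (n C suc j) * f j) + c * f n))
            (k>n⇒nCk≡0 (n<1+n n)) ⟩
  ∑< (suc n) (λ j → (n C j) * f j) + (∑< n (λ j → (n C suc j) * f j) + 0)
    ≡⟨ cong (∑< (suc n) (λ j → (n C j) * f j) +_) (+-identityʳ _) ⟩
  ∑< (suc n) (λ j → (n C j) * f j) + ∑< n (λ j → (n C suc j) * f j) ∎
  where
  open ≡-Reasoning
  split : ∀ j → (suc n C suc j) * f j ≡ (n C j) * f j + (n C suc j) * f j
  split j = trans (cong (_* f j) (sym (nCk+nC[k+1]≡[n+1]C[k+1] n j))) (*-distribʳ-+ (f j) (n C j) (n C suc j))

-- A tuple x is read as the n-periodic sequence i ↦ toℕ (entry x i), on which D acts as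
-- Dseq followed by reduction mod p (toℕ-entry-iter-D); binomial expansions are done in ℕ.

Dseq : (ℕ → ℕ) → ℕ → ℕ
Dseq f i = f i + f (suc i)

iter-Dseq-shift : ∀ n (f : ℕ → ℕ) i j → iter Dseq n (λ l → f (i + l)) j ≡ iter Dseq n f (i + j)
iter-Dseq-shift zero    f i j = refl
iter-Dseq-shift (suc n) f i j =
  cong₂ _+_ (iter-Dseq-shift n f i j) (trans (iter-Dseq-shift n f i (suc j)) (cong (iter Dseq n f) (+-suc i j)))

iter-Dseq-binomial : ∀ n (f : ℕ → ℕ) → iter Dseq n f 0 ≡ ∑< (suc n) (λ j → (n C j) * f j)
iter-Dseq-binomial zero    f = sym (trans (+-identityʳ _) (+-identityʳ (f 0)))
iter-Dseq-binomial (suc n) f = begin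
  iter Dseq n f 0 + iter Dseq n f 1
    ≡⟨ cong₂ _+_ (iter-Dseq-binomial n f) (trans (sym (iter-Dseq-shift n f 1 0)) (iter-Dseq-binomial n (λ j → f (suc j)))) ⟩
  f 0 + 0 + S + T    ≡⟨ rearrange (f 0 + 0) S T ⟩
  f 0 + 0 + (T + S)  ≡⟨ cong (f 0 + 0 +_) (sym (∑<-pascal n (λ j → f (suc j)))) ⟩
  f 0 + 0 + ∑< (suc n) (λ j → (suc n C suc j) * f (suc j)) ∎
  where
  open ≡-Reasoning
  -- (n C 0) * f 0 reduces to f 0 + 0.
  S = ∑< n (λ j → (n C suc j) * f (suc j))
  T = ∑< (suc n) (λ j → (n C j) * f (suc j))
  rearrange : ∀ a b c → a + b + c ≡ a + (c + b)
  rearrange = solve-∀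

Dseq-frobenius : ∀ {p} .{{_ : NonZero p}} → Prime p → (f : ℕ → ℕ) → iter Dseq p f 0 % p ≡ (f 0 + f p) % p
Dseq-frobenius {suc q} p-prime f = begin
  iter Dseq p f 0 % p                          ≡⟨ cong (_% p) (iter-Dseq-binomial p f) ⟩
  (f 0 + 0 + ∑< p inner) % p                   ≡⟨ cong (λ s → (f 0 + 0 + s) % p) (∑<-last q inner) ⟩
  (f 0 + 0 + (∑< q inner + (p C p) * f p)) % p ≡⟨ cong (λ c → (f 0 + 0 + (∑< q inner + c * f p)) % p) (nCn≡1 p) ⟩
  (f 0 + 0 + (∑< q inner + 1 * f p)) % p       ≡⟨ cong (_% p) (rearrange (f 0) (∑< q inner) (f p)) ⟩
  (f 0 + f p + ∑< q inner) % p                 ≡⟨ %-remove-+ʳ (f 0 + f p) (∣-∑< q inner p∣inner) ⟩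
  (f 0 + f p) % p                              ∎
  where
  open ≡-Reasoning
  p = suc q
  inner : ℕ → ℕ
  inner j = (p C suc j) * f (suc j)
  p∣inner : ∀ j → j < q → p ∣ inner j
  p∣inner j j<q = ∣-trans (prime⇒p∣pCk p-prime (s≤s z≤n) (s≤s j<q)) (m∣m*n (f (suc j)))
  rearrange : ∀ a s b → a + 0 + (s + 1 * b) ≡ a + b + s
  rearrange = solve-∀

toℕ-+ₘ : (a b : Fin (suc q)) → toℕ (a +ₘ b) ≡ (toℕ a + toℕ b) % suc q
toℕ-+ₘ a b = toℕ-fromℕ< _

toℕ-entry-iter-D : ∀ n (x : Tuple (suc k) (suc q)) i →
                   toℕ (entry (iter D n x) i) ≡ iter Dseq n (λ j → toℕ (entry x j)) i % suc q
toℕ-entry-iter-D zero    x i = sym (m<n⇒m%n≡m (toℕ<n (entry x i)))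
toℕ-entry-iter-D {q = q} (suc n) x i = begin
  toℕ (entry (D y) i)                             ≡⟨ cong toℕ (entry-D y i) ⟩
  toℕ (entry y i +ₘ entry y (suc i))              ≡⟨ toℕ-+ₘ (entry y i) (entry y (suc i)) ⟩
  (toℕ (entry y i) + toℕ (entry y (suc i))) % p   ≡⟨ cong₂ (λ a b → (a + b) % p) (toℕ-entry-iter-D n x i) (toℕ-entry-iter-D n x (suc i)) ⟩
  (f i % p + f (suc i) % p) % p                   ≡⟨ %-distribˡ-+ (f i) (f (suc i)) p ⟨
  (f i + f (suc i)) % p                           ∎
  where
  open ≡-Reasoning
  p = suc q
  y = iter D n x
  f = iter Dseq n (λ j → toℕ (entry x j))

H∘D^p≡D : Prime (suc q) → suc k ∣ suc (suc q) → (x : Tuple (suc k) (suc q)) → H (iter D (suc q) x) ≡ D x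
H∘D^p≡D {q} {k} p-prime n∣p+1 x = entry-ext _ _ λ i → toℕ-injective (begin
  toℕ (entry (H (iter D p x)) i)               ≡⟨ cong toℕ (entry-H (iter D p x) i) ⟩
  toℕ (entry (iter D p x) (suc i))             ≡⟨ toℕ-entry-iter-D p x (suc i) ⟩
  iter Dseq p f (suc i) % p                    ≡⟨ cong (λ j → iter Dseq p f j % p) (+-identityʳ (suc i)) ⟨
  iter Dseq p f (suc i + 0) % p                ≡⟨ cong (_% p) (iter-Dseq-shift p f (suc i) 0) ⟨
  iter Dseq p (λ l → f (suc i + l)) 0 % p      ≡⟨ Dseq-frobenius p-prime (λ l → f (suc i + l)) ⟩
  (f (suc i + 0) + f (suc i + p)) % p          ≡⟨ cong₂ (λ a b → (f a + b) % p) (+-identityʳ (suc i)) (wrap-around i) ⟩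
  (f (suc i) + f i) % p                        ≡⟨ cong (_% p) (+-comm (f (suc i)) (f i)) ⟩
  (f i + f (suc i)) % p                        ≡⟨ toℕ-+ₘ (entry x i) (entry x (suc i)) ⟨
  toℕ (entry x i +ₘ entry x (suc i))           ≡⟨ cong toℕ (entry-D x i) ⟨
  toℕ (entry (D x) i)                          ∎)
  where
  open ≡-Reasoning
  p = suc q
  f : ℕ → ℕ
  f j = toℕ (entry x j)
  -- This is H^p = H⁻¹, as n ∣ p + 1.
  wrap-around : ∀ i → f (suc i + p) ≡ f i
  wrap-around i = trans (cong f (sym (+-suc i p))) (cong toℕ (entry-periodic x i n∣p+1))

D^[p-1]∘D≡Hinv∘D : Prime (suc q) → suc k ∣ suc (suc q) → (x : Tuple (suc k) (suc q)) →
                   iter D q (D x) ≡ Hinv (D x)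
D^[p-1]∘D≡Hinv∘D {q} p-prime n∣p+1 x = begin
  iter D q (D x)                  ≡⟨ iter-suc D q x ⟨
  iter D (suc q) x                ≡⟨ Hinv-H (iter D (suc q) x) ⟨
  Hinv (H (iter D (suc q) x))     ≡⟨ cong Hinv (H∘D^p≡D p-prime n∣p+1 x) ⟩
  Hinv (D x)                      ∎
  where open ≡-Reasoning

module _ {n m : ℕ} {u : Tuple n m} where

  InCycle-iter : (f : Tuple n m → Tuple n m) → (∀ {v} → InCycle u v → InCycle u (f v)) →
                 ∀ j {v} → InCycle u v → InCycle u (iter f j v)
  InCycle-iter f closed zero    v∈C = v∈C
  InCycle-iter f closed (suc j) v∈C = closed (InCycle-iter f closed j v∈C)

  InCycle-D : ∀ {v} → InCycle u v → InCycle u (D v)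
  InCycle-D (α , β , 1≤β , v≡D^α+β , v≡D^α) = suc α , β , 1≤β , cong D v≡D^α+β , cong D v≡D^α

  InCycle⇒image-D : ∀ {v} → InCycle u v → ∃ λ w → v ≡ D w
  InCycle⇒image-D (α , suc β , _ , v≡D^α+β , _) =
    iter D (α + β) u , trans v≡D^α+β (cong (λ e → iter D e u) (+-suc α β))

module _ (p-prime : Prime (suc q)) (n∣p+1 : suc k ∣ suc (suc q)) {u : Tuple (suc k) (suc q)} where

  D^[p-1]≡Hinv-on-cycle : ∀ {v} → InCycle u v → iter D q v ≡ Hinv v
  D^[p-1]≡Hinv-on-cycle v∈C with InCycle⇒image-D v∈C
  ... | w , refl = D^[p-1]∘D≡Hinv∘D p-prime n∣p+1 w

  InCycle-Hinv : ∀ {v} → InCycle u v → InCycle u (Hinv v)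
  InCycle-Hinv v∈C = subst (InCycle u) (D^[p-1]≡Hinv-on-cycle v∈C) (InCycle-iter D InCycle-D q v∈C)

  InCycle-H : ∀ {v} → InCycle u v → InCycle u (H v)
  InCycle-H {v} v∈C = subst (InCycle u) (sym (H≡Hinv^[n-1] v)) (InCycle-iter Hinv InCycle-Hinv k v∈C)

theorem2 : (n m : ℕ) → 2 ≤ n → 2 ∣ n → Prime m → n ∣ suc m →
    HClosed n m × (∀ (u : Tuple n m) → InK u → iter D (m ∸ 1) u ≡ Hinv u)
theorem2 (suc k) zero    _ _ m-prime _     = ⊥-elim (NonZero.nonZero (prime⇒nonZero m-prime))
theorem2 (suc k) (suc q) _ _ p-prime n∣p+1 = H-closed , D^[p-1]≡Hinv-on-K
  where
  H-closed : HClosed (suc k) (suc q)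
  H-closed u v v∈C (ℤ.+ j)     _ _ = InCycle-iter H (InCycle-H p-prime n∣p+1) j v∈C
  H-closed u v v∈C ℤ.-[1+ j ] _ _ = InCycle-iter Hinv (InCycle-Hinv p-prime n∣p+1) (suc j) v∈C

  D^[p-1]≡Hinv-on-K : ∀ u → InK u → iter D q u ≡ Hinv u
  D^[p-1]≡Hinv-on-K u (_ , u∈C) = D^[p-1]≡Hinv-on-cycle p-prime n∣p+1 u∈C
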